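{- Let $n\ge 2$ and $r\ge 1$ be integers. Then $$\begin{vmatrix}F^{(n)}_{r+1}&F^{(n)}_{r+2}&\cdots&F^{(n)}_{r+n}\\ F^{(n)}_{r}&F^{(n)}_{r+1}&\cdots&F^{(n)}_{r+n-1}\\ \vdots&\vdots&\cdots&\vdots\\ F^{(n)}_{r-n+2}&F^{(n)}_{r-n+3}&\cdots&F^{(n)}_{r+1} \end{vmatrix}=(-1)^{(n-1)r},$$ i.e. the $n\times n$ determinant whose $(i,j)$ entry ($1\le i,j\le n$) is $F^{(n)}_{r+1+j-i}$ equals $(-1)^{(n-1)r}$.
   Context: For an integer $n\ge2$, the $n$-step Fibonacci numbers $F^{(n)}_k$, $k\ge -(n-2)$, are defined by $F^{(n)}_k=0$ for $-(n-2)\le k\le 0$, $F^{(n)}_1=1$, and $F^{(n)}_k=F^{(n)}_{k-1}+F^{(n)}_{k-2}+\cdots+F^{(n)}_{k-n}$ for $k\ge2$. Thus $F^{(n)}_1=F^{(n)}_2=1$, $F^{(n)}_3=2$, …, $F^{(n)}_{n+1}=2^{n-1}$. -}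

module Defs where

open import Data.Nat using (ℕ; zero; suc; _+_)
open import Data.Integer as ℤ using (ℤ)
open import Data.Fin using (Fin; zero; suc; punchIn; toℕ)
open import Data.List using (List; []; _∷_; take)
open import Data.Nat.ListAction using (sum)

-- n-step Fibonacci numbers.
-- window n k = [F_k, F_{k-1}, ..., F_{k-n+1}] (with F_j = 0 for j ≤ 0),
-- as a list of length n (for k ≥ 0 the trailing entries are zeros).
replicate0 : ℕ → List ℕ
replicate0 zero = []
replicate0 (suc m) = 0 ∷ replicate0 m

window : (n : ℕ) → ℕ → List ℕ
window n zero = replicate0 n
window n (suc zero) = take n (1 ∷ replicate0 n)
window n (suc (suc k)) = let w = window n (suc k) in take n (sum w ∷ w)

-- F n k = F^{(n)}_k for k : ℕ (so F n 0 = 0, F n 1 = 1,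
-- F n k = F n (k-1) + ... + F n (k-n) for k ≥ 2, with F_j = 0 for j ≤ 0).
headOr0 : List ℕ → ℕ
headOr0 [] = 0
headOr0 (x ∷ _) = x

Fℕ : ℕ → ℕ → ℕ
Fℕ n k = headOr0 (window n k)

-- F^{(n)}_k for an integer index k; it is 0 for all k ≤ 0
-- (the paper only uses -(n-2) ≤ k, where this is 0 as well).
Fib : ℕ → ℤ → ℕ
Fib n (ℤ.+ k) = Fℕ n k
Fib n (ℤ.-[1+ _ ]) = 0

Σ : (k : ℕ) → (Fin k → ℤ) → ℤ
Σ zero f = ℤ.+ 0
Σ (suc k) f = f zero ℤ.+ Σ k (λ i → f (suc i))

sgn : ℕ → ℤ
sgn zero = ℤ.+ 1
sgn (suc e) = ℤ.- sgn e

det : (m : ℕ) → (Fin m → Fin m → ℤ) → ℤ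
det zero A = ℤ.+ 1
det (suc m) A =
  Σ (suc m) (λ j → sgn (toℕ j) ℤ.* A zero j ℤ.* det m (λ r c → A (suc r) (punchIn j c)))

module Submission where

-- Let M r be the n × n matrix with entries F_{r+1+j-i}.  By the n-step recurrence, the
-- last column of M (r+1) is the sum of all columns of M r, and its other columns are
-- columns 1, …, n-1 of M r.  Expanding by linearity in the last column, every summand
-- that uses column t ≥ 1 of M r has two equal columns and vanishes; the remaining one
-- is M r with its columns cyclically rotated, whose determinant is (-1)^(n-1) det (M r).
-- Since M 0 is upper unitriangular, det (M r) = (-1)^((n-1) r).  The alternating
-- properties of det (defined by first-row Laplace expansion) all follow from the fact
-- that transposing two adjacent columns negates it, proved by induction on the size.

open import Defs

open import Data.Nat as ℕ using (ℕ; zero; suc; _≤_; _<_; _∸_; z<s; s≤s)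
import Data.Nat.Properties as ℕP
open import Data.Nat.Tactic.RingSolver using (solve-∀)
import Data.Integer.Tactic.RingSolver as ZS
open import Data.Fin as Fin
  using (Fin; zero; suc; toℕ; punchIn; punchOut; fromℕ; fromℕ<; inject₁; opposite)
open import Data.Fin.Properties
  using ( toℕ-injective; toℕ-fromℕ<; toℕ-fromℕ; toℕ<n; toℕ-inject₁; opposite-prop
        ; punchIn-injective; punchInᵢ≢i; punchIn-punchOut )
open import Data.Fin.Permutation using (transpose; reverse)
import Data.Fin.Permutation.Components as PC
open import Data.Integer as ℤ using (ℤ; _+_; _*_; -_; +0; +[1+_]; -[1+_])
import Data.Integer.Properties as ℤP
open import Algebra.Properties.CommutativeMonoid.Sum ℤP.+-0-commutativeMonoid
  using (sum; sum-cong-≗; ∑-comm; ∑-permute; sum-replicate-zero)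
open import Algebra.Properties.Semiring.Sum ℤP.+-*-semiring using (*-distribˡ-sum; *-distribʳ-sum)
open import Relation.Binary.PropositionalEquality
open import Relation.Binary.Definitions using (tri<; tri≈; tri>)
open import Relation.Nullary using (Dec; yes; no)
open import Relation.Nullary.Decidable using (dec-true; dec-false)
open import Data.Empty using (⊥-elim)
open import Function using (_∘_)
open import Data.Sum using (inj₁; inj₂)
open import Data.List using (_∷_; take; tabulate)
open import Data.List.Properties using (tabulate-cong)
import Data.Nat.ListAction as List

-- Transpositions, punchIn and rotations of positions

module _ {m : ℕ} where

  transpose-matchˡ : ∀ (i j : Fin m) → PC.transpose i j i ≡ j
  transpose-matchˡ i j rewrite dec-true (i Fin.≟ i) refl = refl

  transpose-matchʳ : ∀ (i j : Fin m) → PC.transpose i j j ≡ i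
  transpose-matchʳ i j with i Fin.≟ j
  ... | yes refl = transpose-matchˡ i i
  ... | no i≢j rewrite dec-false (j Fin.≟ i) (i≢j ∘ sym) | dec-true (j Fin.≟ j) refl = refl

  transpose-other : ∀ {i j k : Fin m} → k ≢ i → k ≢ j → PC.transpose i j k ≡ k
  transpose-other {i} {j} {k} k≢i k≢j
    rewrite dec-false (k Fin.≟ i) k≢i | dec-false (k Fin.≟ j) k≢j = refl

  transpose-involutive : ∀ (i j k : Fin m) → PC.transpose i j (PC.transpose i j k) ≡ k
  transpose-involutive i j k = by-cases (k Fin.≟ i) (k Fin.≟ j)
    where
    τ : Fin m → Fin m
    τ = PC.transpose i j
    by-cases : Dec (k ≡ i) → Dec (k ≡ j) → τ (τ k) ≡ k
    by-cases (yes refl) _          = trans (cong τ (transpose-matchˡ i j)) (transpose-matchʳ i j)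
    by-cases (no _)     (yes refl) = trans (cong τ (transpose-matchʳ i j)) (transpose-matchˡ i j)
    by-cases (no k≢i)   (no k≢j)   = trans (cong τ (transpose-other k≢i k≢j)) (transpose-other k≢i k≢j)

transpose-punchIn : ∀ {m} (j : Fin (suc m)) (x y d : Fin m) →
  PC.transpose (punchIn j x) (punchIn j y) (punchIn j d) ≡ punchIn j (PC.transpose x y d)
transpose-punchIn j x y d = by-cases (d Fin.≟ x) (d Fin.≟ y)
  where
  by-cases : Dec (d ≡ x) → Dec (d ≡ y) →
             PC.transpose (punchIn j x) (punchIn j y) (punchIn j d) ≡ punchIn j (PC.transpose x y d)
  by-cases (yes refl) _ =
    trans (transpose-matchˡ (punchIn j d) (punchIn j y)) (cong (punchIn j) (sym (transpose-matchˡ d y)))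
  by-cases (no _) (yes refl) =
    trans (transpose-matchʳ (punchIn j x) (punchIn j d)) (cong (punchIn j) (sym (transpose-matchʳ x d)))
  by-cases (no d≢x) (no d≢y) =
    trans (transpose-other (d≢x ∘ punchIn-injective j d x) (d≢y ∘ punchIn-injective j d y))
          (cong (punchIn j) (sym (transpose-other d≢x d≢y)))

toℕ-punchIn-< : ∀ {m} (i : Fin (suc m)) (j : Fin m) → toℕ j < toℕ i → toℕ (punchIn i j) ≡ toℕ j
toℕ-punchIn-< (suc i) zero    _         = refl
toℕ-punchIn-< (suc i) (suc j) (s≤s j<i) = cong suc (toℕ-punchIn-< i j j<i)

toℕ-punchIn-≥ : ∀ {m} (i : Fin (suc m)) (j : Fin m) →
  toℕ i ≤ toℕ j → toℕ (punchIn i j) ≡ suc (toℕ j)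
toℕ-punchIn-≥ zero    j       _         = refl
toℕ-punchIn-≥ (suc i) (suc j) (s≤s i≤j) = cong suc (toℕ-punchIn-≥ i j i≤j)

transpose-punchIn-adjacent : ∀ {m} {p q : Fin (suc m)} → toℕ q ≡ suc (toℕ p) →
  ∀ d → PC.transpose p q (punchIn p d) ≡ punchIn q d
transpose-punchIn-adjacent {p = p} {q} q≡1+p d with ℕP.<-cmp (toℕ d) (toℕ p)
... | tri< d<p _ _ =
  trans (transpose-other (≢p ∘ cong toℕ) (≢q ∘ cong toℕ)) (toℕ-injective (trans eqp (sym eqq)))
  where
  eqp : toℕ (punchIn p d) ≡ toℕ d
  eqp = toℕ-punchIn-< p d d<p
  eqq : toℕ (punchIn q d) ≡ toℕ d
  eqq = toℕ-punchIn-< q d (ℕP.<-trans d<p (ℕP.≤-reflexive (sym q≡1+p)))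
  ≢p : toℕ (punchIn p d) ≢ toℕ p
  ≢p e = ℕP.<-irrefl (trans (sym eqp) e) d<p
  ≢q : toℕ (punchIn p d) ≢ toℕ q
  ≢q e = ℕP.<-irrefl (trans (sym eqp) (trans e q≡1+p)) (ℕP.<-trans d<p (ℕP.n<1+n (toℕ p)))
... | tri≈ _ d≡p _ = trans (cong (PC.transpose p q) pd≡q) (trans (transpose-matchʳ p q) (sym qd≡p))
  where
  pd≡q : punchIn p d ≡ q
  pd≡q = toℕ-injective
    (trans (toℕ-punchIn-≥ p d (ℕP.≤-reflexive (sym d≡p))) (trans (cong suc d≡p) (sym q≡1+p)))
  qd≡p : punchIn q d ≡ p
  qd≡p = toℕ-injective
    (trans (toℕ-punchIn-< q d (ℕP.≤-reflexive (trans (cong suc d≡p) (sym q≡1+p)))) d≡p)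
... | tri> _ _ p<d =
  trans (transpose-other (≢p ∘ cong toℕ) (≢q ∘ cong toℕ)) (toℕ-injective (trans eqp (sym eqq)))
  where
  eqp : toℕ (punchIn p d) ≡ suc (toℕ d)
  eqp = toℕ-punchIn-≥ p d (ℕP.<⇒≤ p<d)
  eqq : toℕ (punchIn q d) ≡ suc (toℕ d)
  eqq = toℕ-punchIn-≥ q d (ℕP.≤-trans (ℕP.≤-reflexive q≡1+p) p<d)
  ≢p : toℕ (punchIn p d) ≢ toℕ p
  ≢p e = ℕP.<-irrefl (sym e) (ℕP.<-trans p<d (ℕP.≤-reflexive (sym eqp)))
  ≢q : toℕ (punchIn p d) ≢ toℕ q
  ≢q e = ℕP.<-irrefl (trans (sym q≡1+p) (trans (sym e) eqp)) (s≤s p<d)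

punchIn-cancel-adjacent : ∀ {m} (j : Fin (suc m)) {x y : Fin m} →
  toℕ (punchIn j y) ≡ suc (toℕ (punchIn j x)) → toℕ y ≡ suc (toℕ x)
punchIn-cancel-adjacent j {x} {y} e with toℕ x ℕ.<? toℕ j | toℕ y ℕ.<? toℕ j
... | yes x<j | yes y<j = trans (sym (toℕ-punchIn-< j y y<j)) (trans e (cong suc (toℕ-punchIn-< j x x<j)))
... | no x≮j  | no y≮j  = ℕP.suc-injective (trans (sym (toℕ-punchIn-≥ j y (ℕP.≮⇒≥ y≮j)))
                                            (trans e (cong suc (toℕ-punchIn-≥ j x (ℕP.≮⇒≥ x≮j)))))
... | yes x<j | no y≮j  = ⊥-elim (y≮j (begin-strict
  toℕ y                       <⟨ ℕP.n<1+n (toℕ y) ⟩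
  suc (toℕ y)                 ≡⟨ toℕ-punchIn-≥ j y (ℕP.≮⇒≥ y≮j) ⟨
  toℕ (punchIn j y)           ≡⟨ e ⟩
  suc (toℕ (punchIn j x))     ≡⟨ cong suc (toℕ-punchIn-< j x x<j) ⟩
  suc (toℕ x)                 ≤⟨ x<j ⟩
  toℕ j                       ∎))
  where open ℕP.≤-Reasoning
... | no x≮j  | yes y<j = ⊥-elim (ℕP.<-irrefl refl (begin-strict
  toℕ j                       ≤⟨ ℕP.≮⇒≥ x≮j ⟩
  toℕ x                       <⟨ ℕP.n<1+n (toℕ x) ⟩
  suc (toℕ x)                 ≡⟨ toℕ-punchIn-≥ j x (ℕP.≮⇒≥ x≮j) ⟨
  toℕ (punchIn j x)           <⟨ ℕP.n<1+n _ ⟩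
  suc (toℕ (punchIn j x))     ≡⟨ e ⟨
  toℕ (punchIn j y)           ≡⟨ toℕ-punchIn-< j y y<j ⟩
  toℕ y                       <⟨ y<j ⟩
  toℕ j                       ∎))
  where open ℕP.≤-Reasoning

-- rotate k sends j to j + 1 for j < k and k to 0, fixing the positions beyond k.
rotate : ∀ {m} k → k < m → Fin m → Fin m
rotate zero    _     j = j
rotate (suc k) 1+k<m j =
  rotate k (ℕP.<⇒≤ 1+k<m) (PC.transpose (fromℕ< (ℕP.<⇒≤ 1+k<m)) (fromℕ< 1+k<m) j)

rotate-> : ∀ {m} k (k<m : k < m) (j : Fin m) → k < toℕ j → rotate k k<m j ≡ j
rotate-> zero    _     j _       = refl
rotate-> (suc k) 1+k<m j 1+k<j = trans (cong (rotate k k<m) (transpose-other j≢P j≢Q)) (rotate-> k k<m j k<j)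
  where
  k<m : k < _
  k<m = ℕP.<⇒≤ 1+k<m
  k<j : k < toℕ j
  k<j = ℕP.<-trans (ℕP.n<1+n k) 1+k<j
  j≢P : j ≢ fromℕ< k<m
  j≢P j≡P = ℕP.<-irrefl (sym (trans (cong toℕ j≡P) (toℕ-fromℕ< k<m))) k<j
  j≢Q : j ≢ fromℕ< 1+k<m
  j≢Q j≡Q = ℕP.<-irrefl (sym (trans (cong toℕ j≡Q) (toℕ-fromℕ< 1+k<m))) 1+k<j

rotate-≡ : ∀ {m} k (k<m : k < m) (j : Fin m) → toℕ j ≡ k → toℕ (rotate k k<m j) ≡ 0
rotate-≡ zero    _     j j≡0   = j≡0
rotate-≡ (suc k) 1+k<m j j≡1+k = begin
  toℕ (rotate k k<m (PC.transpose P Q j)) ≡⟨ cong (toℕ ∘ rotate k k<m ∘ PC.transpose P Q) j≡Q ⟩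
  toℕ (rotate k k<m (PC.transpose P Q Q)) ≡⟨ cong (toℕ ∘ rotate k k<m) (transpose-matchʳ P Q) ⟩
  toℕ (rotate k k<m P)                    ≡⟨ rotate-≡ k k<m P (toℕ-fromℕ< k<m) ⟩
  0                                       ∎
  where
  open ≡-Reasoning
  k<m : k < _
  k<m = ℕP.<⇒≤ 1+k<m
  P Q : Fin _
  P = fromℕ< k<m
  Q = fromℕ< 1+k<m
  j≡Q : j ≡ Q
  j≡Q = toℕ-injective (trans j≡1+k (sym (toℕ-fromℕ< 1+k<m)))

rotate-< : ∀ {m} k (k<m : k < m) (j : Fin m) → toℕ j < k → toℕ (rotate k k<m j) ≡ suc (toℕ j)
rotate-< (suc k) 1+k<m j j<1+k with ℕP.m<1+n⇒m<n∨m≡n j<1+k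
... | inj₁ j<k = trans (cong (toℕ ∘ rotate k k<m) (transpose-other j≢P j≢Q)) (rotate-< k k<m j j<k)
  where
  k<m : k < _
  k<m = ℕP.<⇒≤ 1+k<m
  j≢P : j ≢ fromℕ< k<m
  j≢P j≡P = ℕP.<-irrefl (trans (cong toℕ j≡P) (toℕ-fromℕ< k<m)) j<k
  j≢Q : j ≢ fromℕ< 1+k<m
  j≢Q j≡Q = ℕP.<-irrefl (trans (cong toℕ j≡Q) (toℕ-fromℕ< 1+k<m)) j<1+k
... | inj₂ j≡k = begin
  toℕ (rotate k k<m (PC.transpose P Q j)) ≡⟨ cong (toℕ ∘ rotate k k<m ∘ PC.transpose P Q) j≡P ⟩
  toℕ (rotate k k<m (PC.transpose P Q P)) ≡⟨ cong (toℕ ∘ rotate k k<m) (transpose-matchˡ P Q) ⟩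
  toℕ (rotate k k<m Q)                    ≡⟨ cong toℕ (rotate-> k k<m Q (ℕP.≤-reflexive (sym Q≡1+k))) ⟩
  toℕ Q                                   ≡⟨ trans Q≡1+k (cong suc (sym j≡k)) ⟩
  suc (toℕ j)                             ∎
  where
  open ≡-Reasoning
  k<m : k < _
  k<m = ℕP.<⇒≤ 1+k<m
  P Q : Fin _
  P = fromℕ< k<m
  Q = fromℕ< 1+k<m
  Q≡1+k : toℕ Q ≡ suc k
  Q≡1+k = toℕ-fromℕ< 1+k<m
  j≡P : j ≡ P
  j≡P = toℕ-injective (trans j≡k (sym (toℕ-fromℕ< k<m)))

sum-zero : ∀ {k} {f : Fin k → ℤ} → (∀ t → f t ≡ +0) → sum f ≡ +0
sum-zero {k} f≗0 = trans (sum-cong-≗ f≗0) (sum-replicate-zero k)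

sum-neg : ∀ {k} (f : Fin k → ℤ) → sum (λ t → - f t) ≡ - sum f
sum-neg f = begin
  sum (λ t → - f t)        ≡⟨ sum-cong-≗ (λ t → sym (ℤP.-1*i≡-i (f t))) ⟩
  sum (λ t → ℤ.-1ℤ * f t)  ≡⟨ sym (*-distribˡ-sum ℤ.-1ℤ f) ⟩
  ℤ.-1ℤ * sum f            ≡⟨ ℤP.-1*i≡-i (sum f) ⟩
  - sum f                  ∎
  where open ≡-Reasoning

Σ≡sum : ∀ k (f : Fin k → ℤ) → Σ k f ≡ sum f
Σ≡sum zero    f = refl
Σ≡sum (suc k) f = cong (f zero +_) (Σ≡sum k (f ∘ suc))

Matrix : ℕ → Set
Matrix m = Fin m → Fin m → ℤ

minor : ∀ {m} → Matrix (suc m) → Fin (suc m) → Matrix m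
minor A j r c = A (suc r) (punchIn j c)

laplaceTerm : ∀ {m} → Matrix (suc m) → Fin (suc m) → ℤ
laplaceTerm {m} A j = sgn (toℕ j) * A zero j * det m (minor A j)

det-expand : ∀ m (A : Matrix (suc m)) → det (suc m) A ≡ sum (laplaceTerm A)
det-expand m A = Σ≡sum (suc m) (laplaceTerm A)

det-cong : ∀ m {A B : Matrix m} → (∀ i j → A i j ≡ B i j) → det m A ≡ det m B
det-cong zero    A≗B = refl
det-cong (suc m) {A} {B} A≗B = begin
  det (suc m) A        ≡⟨ det-expand m A ⟩
  sum (laplaceTerm A)  ≡⟨ sum-cong-≗ term≗ ⟩
  sum (laplaceTerm B)  ≡⟨ det-expand m B ⟨
  det (suc m) B        ∎
  where
  open ≡-Reasoning
  term≗ : ∀ j → laplaceTerm A j ≡ laplaceTerm B j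
  term≗ j = cong₂ (λ a d → sgn (toℕ j) * a * d) (A≗B zero j)
                  (det-cong m (λ r c → A≗B (suc r) (punchIn j c)))

-- Column operations

neg-distribˡ-*-* : ∀ a b c → (- a) * b * c ≡ - (a * b * c)
neg-distribˡ-*-* a b c =
  sym (trans (ℤP.neg-distribˡ-* (a * b) c) (cong (_* c) (ℤP.neg-distribˡ-* a b)))

laplaceTerm-opposite : ∀ {m} (A B : Matrix (suc m)) {x y} → sgn (toℕ x) ≡ - sgn (toℕ y) →
  B zero x ≡ A zero y → (∀ r d → minor B x r d ≡ minor A y r d) → laplaceTerm B x ≡ - laplaceTerm A y
laplaceTerm-opposite {m} A B {x} {y} sx≡-sy b≡a minors = begin
  sgn (toℕ x) * B zero x * det m (minor B x)
    ≡⟨ cong₂ (λ s b → s * b * det m (minor B x)) sx≡-sy b≡a ⟩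
  (- sgn (toℕ y)) * A zero y * det m (minor B x)
    ≡⟨ cong ((- sgn (toℕ y)) * A zero y *_) (det-cong m minors) ⟩
  (- sgn (toℕ y)) * A zero y * det m (minor A y)
    ≡⟨ neg-distribˡ-*-* (sgn (toℕ y)) (A zero y) (det m (minor A y)) ⟩
  - laplaceTerm A y
    ∎
  where open ≡-Reasoning

minor-transpose : ∀ {m} (A B : Matrix (suc m)) {p q j : Fin (suc m)} (j≢p : j ≢ p) (j≢q : j ≢ q) →
  (∀ i k → B i k ≡ A i (PC.transpose p q k)) →
  ∀ r d → minor B j r d ≡ minor A j r (PC.transpose (punchOut j≢p) (punchOut j≢q) d)
minor-transpose A B {p} {q} {j} j≢p j≢q B≗Aτ r d =
  trans (B≗Aτ (suc r) (punchIn j d)) (cong (A (suc r)) (begin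
    PC.transpose p q (punchIn j d)
      ≡⟨ cong₂ (λ u v → PC.transpose u v (punchIn j d)) (punchIn-punchOut j≢p) (punchIn-punchOut j≢q) ⟨
    PC.transpose (punchIn j p') (punchIn j q') (punchIn j d)
      ≡⟨ transpose-punchIn j p' q' d ⟩
    punchIn j (PC.transpose p' q' d)
      ∎))
  where
  open ≡-Reasoning
  p' q' : Fin _
  p' = punchOut j≢p
  q' = punchOut j≢q

det-transpose-adjacent : ∀ m (A B : Matrix m) {p q : Fin m} → toℕ q ≡ suc (toℕ p) →
  (∀ i j → B i j ≡ A i (PC.transpose p q j)) → det m B ≡ - det m A
det-transpose-adjacent (suc m) A B {p} {q} q≡1+p B≗Aτ = begin
  det (suc m) B                      ≡⟨ det-expand m B ⟩
  sum (laplaceTerm B)                ≡⟨ sum-cong-≗ term≗ ⟩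
  sum (λ j → - laplaceTerm A (τ j))  ≡⟨ sum-neg (laplaceTerm A ∘ τ) ⟩
  - sum (laplaceTerm A ∘ τ)          ≡⟨ cong -_ (∑-permute (laplaceTerm A) (transpose p q)) ⟨
  - sum (laplaceTerm A)              ≡⟨ cong -_ (det-expand m A) ⟨
  - det (suc m) A                    ∎
  where
  open ≡-Reasoning
  τ : Fin (suc m) → Fin (suc m)
  τ = PC.transpose p q
  sgn-q : sgn (toℕ q) ≡ - sgn (toℕ p)
  sgn-q = cong sgn q≡1+p
  sgn-p : sgn (toℕ p) ≡ - sgn (toℕ q)
  sgn-p = sym (trans (cong -_ sgn-q) (ℤP.neg-involutive (sgn (toℕ p))))
  τqd≡pd : ∀ d → τ (punchIn q d) ≡ punchIn p d
  τqd≡pd d = trans (cong τ (sym (transpose-punchIn-adjacent q≡1+p d)))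
                   (transpose-involutive p q (punchIn p d))

  -- Off {p, q} the minors are again related by an adjacent transposition; at p and q
  -- the minors of B and A coincide crosswise and the signs differ.
  term≗ : ∀ j → laplaceTerm B j ≡ - laplaceTerm A (τ j)
  term≗ j = by-cases (j Fin.≟ p) (j Fin.≟ q)
    where
    by-cases : Dec (j ≡ p) → Dec (j ≡ q) → laplaceTerm B j ≡ - laplaceTerm A (τ j)
    by-cases (yes refl) _ = trans
      (laplaceTerm-opposite A B sgn-p (trans (B≗Aτ zero p) (cong (A zero) (transpose-matchˡ p q)))
        (λ r d → trans (B≗Aτ (suc r) (punchIn p d))
                       (cong (A (suc r)) (transpose-punchIn-adjacent q≡1+p d))))
      (cong (-_ ∘ laplaceTerm A) (sym (transpose-matchˡ p q)))
    by-cases (no _) (yes refl) = trans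
      (laplaceTerm-opposite A B sgn-q (trans (B≗Aτ zero q) (cong (A zero) (transpose-matchʳ p q)))
        (λ r d → trans (B≗Aτ (suc r) (punchIn q d)) (cong (A (suc r)) (τqd≡pd d))))
      (cong (-_ ∘ laplaceTerm A) (sym (transpose-matchʳ p q)))
    by-cases (no j≢p) (no j≢q) = begin
      sgn (toℕ j) * B zero j * det m (minor B j)
        ≡⟨ cong₂ (λ b d → sgn (toℕ j) * b * d) (trans (B≗Aτ zero j) (cong (A zero) τj≡j))
                 (det-transpose-adjacent m (minor A j) (minor B j) q'≡1+p' (minor-transpose A B j≢p j≢q B≗Aτ)) ⟩
      sgn (toℕ j) * A zero j * - det m (minor A j)
        ≡⟨ ℤP.neg-distribʳ-* (sgn (toℕ j) * A zero j) _ ⟨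
      - laplaceTerm A j
        ≡⟨ cong (-_ ∘ laplaceTerm A) τj≡j ⟨
      - laplaceTerm A (τ j)
        ∎
      where
      τj≡j : τ j ≡ j
      τj≡j = transpose-other j≢p j≢q
      q'≡1+p' : toℕ (punchOut j≢q) ≡ suc (toℕ (punchOut j≢p))
      q'≡1+p' = punchIn-cancel-adjacent j (begin
        toℕ (punchIn j (punchOut j≢q))        ≡⟨ cong toℕ (punchIn-punchOut j≢q) ⟩
        toℕ q                                 ≡⟨ q≡1+p ⟩
        suc (toℕ p)                           ≡⟨ cong (suc ∘ toℕ) (punchIn-punchOut j≢p) ⟨
        suc (toℕ (punchIn j (punchOut j≢p)))  ∎)

i≡-i⇒i≡0 : ∀ {i} → i ≡ - i → i ≡ +0
i≡-i⇒i≡0 {+0}        _  = refl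
i≡-i⇒i≡0 {+[1+ _ ]}  ()
i≡-i⇒i≡0 { -[1+ _ ]} ()

transpose-equal-columns : ∀ {m} (A : Matrix m) {p q : Fin m} → (∀ i → A i p ≡ A i q) →
  ∀ i j → A i j ≡ A i (PC.transpose p q j)
transpose-equal-columns A {p} {q} p≗q i j = by-cases (j Fin.≟ p) (j Fin.≟ q)
  where
  by-cases : Dec (j ≡ p) → Dec (j ≡ q) → A i j ≡ A i (PC.transpose p q j)
  by-cases (yes refl) _          = trans (p≗q i) (cong (A i) (sym (transpose-matchˡ p q)))
  by-cases (no _)     (yes refl) = trans (sym (p≗q i)) (cong (A i) (sym (transpose-matchʳ p q)))
  by-cases (no j≢p)   (no j≢q)   = cong (A i) (sym (transpose-other j≢p j≢q))

det-equal-columns-at-distance : ∀ d m (A : Matrix m) {p q : Fin m} → toℕ q ≡ suc (d ℕ.+ toℕ p) →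
  (∀ i → A i p ≡ A i q) → det m A ≡ +0
det-equal-columns-at-distance zero m A q≡1+p p≗q =
  i≡-i⇒i≡0 (det-transpose-adjacent m A A q≡1+p (transpose-equal-columns A p≗q))
det-equal-columns-at-distance (suc d) m A {p} {q} q≡2+d+p p≗q = ℤP.neg-injective (begin
  - det m A  ≡⟨ det-transpose-adjacent m A B q≡1+r (λ _ _ → refl) ⟨
  det m B    ≡⟨ det-equal-columns-at-distance d m B r≡1+d+p B-p≗r ⟩
  +0         ∎)
  where
  open ≡-Reasoning
  r<m : suc (d ℕ.+ toℕ p) < m
  r<m = ℕP.<-trans (ℕP.n<1+n _) (subst (_< m) q≡2+d+p (toℕ<n q))
  r : Fin m
  r = fromℕ< r<m
  r≡1+d+p : toℕ r ≡ suc (d ℕ.+ toℕ p)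
  r≡1+d+p = toℕ-fromℕ< r<m
  q≡1+r : toℕ q ≡ suc (toℕ r)
  q≡1+r = trans q≡2+d+p (cong suc (sym r≡1+d+p))
  B : Matrix m
  B i j = A i (PC.transpose r q j)
  B-p≗r : ∀ i → B i p ≡ B i r
  B-p≗r i = begin
    A i (PC.transpose r q p) ≡⟨ cong (A i) (transpose-other p≢r p≢q) ⟩
    A i p                    ≡⟨ p≗q i ⟩
    A i q                    ≡⟨ cong (A i) (transpose-matchˡ r q) ⟨
    A i (PC.transpose r q r) ∎
    where
    p≢r : p ≢ r
    p≢r p≡r = ℕP.<-irrefl (cong toℕ p≡r) (subst (toℕ p <_) (sym r≡1+d+p) (s≤s (ℕP.m≤n+m (toℕ p) d)))
    p≢q : p ≢ q
    p≢q p≡q = ℕP.<-irrefl (cong toℕ p≡q) (subst (toℕ p <_) (sym q≡2+d+p) (s≤s (ℕP.m≤n+m (toℕ p) (suc d))))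

det-equal-columns : ∀ m (A : Matrix m) {p q : Fin m} → toℕ p < toℕ q →
  (∀ i → A i p ≡ A i q) → det m A ≡ +0
det-equal-columns m A {p} {q} p<q = det-equal-columns-at-distance (toℕ q ∸ suc (toℕ p)) m A
  (sym (trans (sym (ℕP.+-suc _ (toℕ p))) (ℕP.m∸n+n≡m p<q)))

det-rotate : ∀ m k (k<m : k < m) (A : Matrix m) → det m (λ i j → A i (rotate k k<m j)) ≡ sgn k * det m A
det-rotate m zero    _     A = sym (ℤP.*-identityˡ (det m A))
det-rotate m (suc k) 1+k<m A = begin
  det m (λ i j → A i (rotate (suc k) 1+k<m j)) ≡⟨ det-transpose-adjacent m _ _ Q≡1+P (λ _ _ → refl) ⟩
  - det m (λ i j → A i (rotate k k<m j))       ≡⟨ cong -_ (det-rotate m k k<m A) ⟩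
  - (sgn k * det m A)                          ≡⟨ ℤP.neg-distribˡ-* (sgn k) (det m A) ⟩
  sgn (suc k) * det m A                        ∎
  where
  open ≡-Reasoning
  k<m : k < m
  k<m = ℕP.<⇒≤ 1+k<m
  Q≡1+P : toℕ (fromℕ< 1+k<m) ≡ suc (toℕ (fromℕ< k<m))
  Q≡1+P = trans (toℕ-fromℕ< 1+k<m) (cong suc (sym (toℕ-fromℕ< k<m)))

det-linear-column : ∀ m {k} (c : Fin m) (A : Matrix m) (B : Fin k → Matrix m) →
  (∀ i → A i c ≡ sum (λ t → B t i c)) → (∀ t i j → j ≢ c → B t i j ≡ A i j) →
  det m A ≡ sum (λ t → det m (B t))
det-linear-column (suc m) c A B column-c other-columns = begin
  det (suc m) A                                ≡⟨ det-expand m A ⟩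
  sum (laplaceTerm A)                          ≡⟨ sum-cong-≗ term≗ ⟩
  sum (λ j → sum (λ t → laplaceTerm (B t) j))  ≡⟨ ∑-comm (λ j t → laplaceTerm (B t) j) ⟩
  sum (λ t → sum (laplaceTerm (B t)))          ≡⟨ sum-cong-≗ (λ t → det-expand m (B t)) ⟨
  sum (λ t → det (suc m) (B t))                ∎
  where
  open ≡-Reasoning
  term≗ : ∀ j → laplaceTerm A j ≡ sum (λ t → laplaceTerm (B t) j)
  term≗ j with j Fin.≟ c
  ... | yes refl = begin
    s * A zero j * D                    ≡⟨ cong (λ a → s * a * D) (column-c zero) ⟩
    s * sum (λ t → B t zero j) * D      ≡⟨ cong (_* D) (*-distribˡ-sum s (λ t → B t zero j)) ⟩
    sum (λ t → s * B t zero j) * D      ≡⟨ *-distribʳ-sum D (λ t → s * B t zero j) ⟩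
    sum (λ t → s * B t zero j * D)      ≡⟨ sum-cong-≗ (λ t → cong (s * B t zero j *_)
                                                                   (det-cong m (same-minor t))) ⟩
    sum (λ t → laplaceTerm (B t) j)     ∎
    where
    s D : ℤ
    s = sgn (toℕ j)
    D = det m (minor A j)
    same-minor : ∀ t r d → minor A j r d ≡ minor (B t) j r d
    same-minor t r d = sym (other-columns t (suc r) (punchIn j d) (punchInᵢ≢i j d))
  ... | no j≢c = begin
    s * A zero j * det m (minor A j)
      ≡⟨ cong (s * A zero j *_) minor-linear ⟩
    s * A zero j * sum (λ t → det m (minor (B t) j))
      ≡⟨ *-distribˡ-sum (s * A zero j) (λ t → det m (minor (B t) j)) ⟩
    sum (λ t → s * A zero j * det m (minor (B t) j))
      ≡⟨ sum-cong-≗ (λ t → cong (λ a → s * a * det m (minor (B t) j)) (sym (other-columns t zero j j≢c))) ⟩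
    sum (λ t → laplaceTerm (B t) j)
      ∎
    where
    s : ℤ
    s = sgn (toℕ j)
    c' : Fin m
    c' = punchOut j≢c
    c'↦c : punchIn j c' ≡ c
    c'↦c = punchIn-punchOut j≢c
    minor-linear : det m (minor A j) ≡ sum (λ t → det m (minor (B t) j))
    minor-linear = det-linear-column m c' (minor A j) (λ t → minor (B t) j)
      (λ r → subst (λ x → A (suc r) x ≡ sum (λ t → B t (suc r) x)) (sym c'↦c) (column-c (suc r)))
      (λ t r d d≢c' → other-columns t (suc r) (punchIn j d)
                        (λ e → d≢c' (punchIn-injective j d c' (trans e (sym c'↦c)))))

det-zero-column : ∀ m (c : Fin m) (A : Matrix m) → (∀ i → A i c ≡ +0) → det m A ≡ +0
det-zero-column m c A column-c = det-linear-column m {0} c A (λ ()) column-c (λ ())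

det-upper-unitriangular : ∀ m (A : Matrix m) →
  (∀ i j → toℕ j < toℕ i → A i j ≡ +0) → (∀ i → A i i ≡ ℤ.1ℤ) → det m A ≡ ℤ.1ℤ
det-upper-unitriangular zero    A below-diagonal diagonal = refl
det-upper-unitriangular (suc m) A below-diagonal diagonal = begin
  det (suc m) A                                           ≡⟨ det-expand m A ⟩
  laplaceTerm A zero + sum (λ j → laplaceTerm A (suc j))  ≡⟨ cong₂ _+_ first-term (sum-zero other-term) ⟩
  ℤ.1ℤ + +0                                               ∎
  where
  open ≡-Reasoning
  first-term : laplaceTerm A zero ≡ ℤ.1ℤ
  first-term = cong₂ (λ a d → ℤ.1ℤ * a * d) (diagonal zero)
    (det-upper-unitriangular m (minor A zero) (λ i j j<i → below-diagonal (suc i) (suc j) (s≤s j<i))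
                             (diagonal ∘ suc))
  minor-first-column : ∀ j → det m (minor A (suc j)) ≡ +0
  minor-first-column zero    = det-zero-column m zero (minor A (suc zero)) (λ i → below-diagonal (suc i) zero z<s)
  minor-first-column (suc j) = det-zero-column m zero (minor A (suc (suc j))) (λ i → below-diagonal (suc i) zero z<s)
  other-term : ∀ j → laplaceTerm A (suc j) ≡ +0
  other-term j = trans (cong (sgn (toℕ (suc j)) * A zero (suc j) *_) (minor-first-column j))
                       (ℤP.*-zeroʳ (sgn (toℕ (suc j)) * A zero (suc j)))

setColumn : ∀ {m} → Matrix m → Fin m → (Fin m → ℤ) → Matrix m
setColumn A c v i j with j Fin.≟ c
... | yes _ = v i
... | no  _ = A i j

setColumn-≡ : ∀ {m} (A : Matrix m) c v i → setColumn A c v i c ≡ v i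
setColumn-≡ A c v i with c Fin.≟ c
... | yes _   = refl
... | no  c≢c = ⊥-elim (c≢c refl)

setColumn-≢ : ∀ {m} (A : Matrix m) {c j} v i → j ≢ c → setColumn A c v i j ≡ A i j
setColumn-≢ A {c} {j} v i j≢c with j Fin.≟ c
... | yes j≡c = ⊥-elim (j≢c j≡c)
... | no  _   = refl

-- n-step Fibonacci numbers

Fℕ-zero : ∀ n → Fℕ n 0 ≡ 0
Fℕ-zero zero    = refl
Fℕ-zero (suc n) = refl

Fib-neg : ∀ n x → Fib n (- ℤ.+ x) ≡ 0
Fib-neg n zero    = Fℕ-zero n
Fib-neg n (suc x) = refl

Fib-sub : ∀ n a b → Fib n (ℤ.+ a ℤ.- ℤ.+ b) ≡ Fℕ n (a ∸ b)
Fib-sub n a b with ℕP.≤-total b a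
... | inj₁ b≤a = cong (Fib n) (trans (ℤP.m-n≡m⊖n a b) (ℤP.⊖-≥ b≤a))
... | inj₂ a≤b = begin
  Fib n (ℤ.+ a ℤ.- ℤ.+ b)  ≡⟨ cong (Fib n) (trans (ℤP.m-n≡m⊖n a b) (ℤP.⊖-≤ a≤b)) ⟩
  Fib n (- ℤ.+ (b ∸ a))    ≡⟨ Fib-neg n (b ∸ a) ⟩
  0                        ≡⟨ Fℕ-zero n ⟨
  Fℕ n 0                   ≡⟨ cong (Fℕ n) (ℕP.m≤n⇒m∸n≡0 a≤b) ⟨
  Fℕ n (a ∸ b)             ∎
  where open ≡-Reasoning

Fℕ-0∸ : ∀ n {m} (t : Fin m) → Fℕ n (0 ∸ toℕ t) ≡ 0
Fℕ-0∸ n t = trans (cong (Fℕ n) (ℕP.0∸n≡0 (toℕ t))) (Fℕ-zero n)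

tabulate-zeros : ∀ {m} {f : Fin m → ℕ} → (∀ t → f t ≡ 0) → tabulate f ≡ replicate0 m
tabulate-zeros {zero}  f≗0 = refl
tabulate-zeros {suc m} f≗0 = cong₂ _∷_ (f≗0 zero) (tabulate-zeros (f≗0 ∘ suc))

take-replicate0 : ∀ m → take m (replicate0 (suc m)) ≡ replicate0 m
take-replicate0 zero    = refl
take-replicate0 (suc m) = cong (0 ∷_) (take-replicate0 m)

take-tabulate : ∀ {A : Set} m (f : Fin (suc m) → A) → take m (tabulate f) ≡ tabulate (f ∘ inject₁)
take-tabulate zero    f = refl
take-tabulate (suc m) f = cong (f zero ∷_) (take-tabulate m (f ∘ suc))

window-tabulate : ∀ n k → window (suc n) k ≡ tabulate (λ (t : Fin (suc n)) → Fℕ (suc n) (k ∸ toℕ t))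
window-tabulate n zero         = sym (tabulate-zeros (Fℕ-0∸ (suc n)))
window-tabulate n (suc zero)   = cong (1 ∷_) (trans (take-replicate0 n) (sym (tabulate-zeros (Fℕ-0∸ (suc n)))))
window-tabulate n (suc (suc k)) = cong (List.sum (window (suc n) (suc k)) ∷_) (begin
  take n (window (suc n) (suc k))
    ≡⟨ cong (take n) (window-tabulate n (suc k)) ⟩
  take n (tabulate (λ t → Fℕ (suc n) (suc k ∸ toℕ t)))
    ≡⟨ take-tabulate n (λ t → Fℕ (suc n) (suc k ∸ toℕ t)) ⟩
  tabulate (λ t → Fℕ (suc n) (suc k ∸ toℕ (inject₁ t)))
    ≡⟨ tabulate-cong (λ t → cong (λ x → Fℕ (suc n) (suc k ∸ x)) (toℕ-inject₁ t)) ⟩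
  tabulate (λ (t : Fin n) → Fℕ (suc n) (suc k ∸ toℕ t))
    ∎)
  where open ≡-Reasoning

pos-sum-tabulate : ∀ {m} (f : Fin m → ℕ) → ℤ.+ List.sum (tabulate f) ≡ sum (λ t → ℤ.+ f t)
pos-sum-tabulate {zero}  f = refl
pos-sum-tabulate {suc m} f =
  trans (ℤP.pos-+ (f zero) _) (cong (ℤ.+ f zero +_) (pos-sum-tabulate (f ∘ suc)))

Fℕ-recurrence : ∀ n k →
  ℤ.+ Fℕ (suc n) (suc (suc k)) ≡ sum (λ (t : Fin (suc n)) → ℤ.+ Fℕ (suc n) (suc k ∸ toℕ t))
Fℕ-recurrence n k = trans (cong (ℤ.+_ ∘ List.sum) (window-tabulate n (suc k)))
                          (pos-sum-tabulate (λ (t : Fin (suc n)) → Fℕ (suc n) (suc k ∸ toℕ t)))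

pos-sub-pos-≡ : ∀ {x y z w} → x ℕ.+ w ≡ z ℕ.+ y → ℤ.+ x ℤ.- ℤ.+ y ≡ ℤ.+ z ℤ.- ℤ.+ w
pos-sub-pos-≡ {x} {y} {z} {w} x+w≡z+y = begin
  ℤ.+ x ℤ.- ℤ.+ y                          ≡⟨ add-both (ℤ.+ x) (ℤ.+ y) (ℤ.+ w) ⟩
  (ℤ.+ x + ℤ.+ w) ℤ.- (ℤ.+ y + ℤ.+ w)      ≡⟨ cong (ℤ._- (ℤ.+ y + ℤ.+ w)) x+w≡z+y′ ⟩
  (ℤ.+ z + ℤ.+ y) ℤ.- (ℤ.+ y + ℤ.+ w)      ≡⟨ cancel-middle (ℤ.+ z) (ℤ.+ y) (ℤ.+ w) ⟩
  ℤ.+ z ℤ.- ℤ.+ w                          ∎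
  where
  open ≡-Reasoning
  x+w≡z+y′ : ℤ.+ x + ℤ.+ w ≡ ℤ.+ z + ℤ.+ y
  x+w≡z+y′ = trans (sym (ℤP.pos-+ x w)) (trans (cong ℤ.+_ x+w≡z+y) (ℤP.pos-+ z y))
  add-both : ∀ a b c → a ℤ.- b ≡ (a + c) ℤ.- (b + c)
  add-both = ZS.solve-∀
  cancel-middle : ∀ a b c → (a + b) ℤ.- (b + c) ≡ a ℤ.- c
  cancel-middle = ZS.solve-∀

-- The Fibonacci matrices

sgn-+ : ∀ a b → sgn (a ℕ.+ b) ≡ sgn a * sgn b
sgn-+ zero    b = sym (ℤP.*-identityˡ (sgn b))
sgn-+ (suc a) b = trans (cong -_ (sgn-+ a b)) (ℤP.neg-distribˡ-* (sgn a) (sgn b))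

fibMatrix : ∀ n → ℕ → Matrix n
fibMatrix n r i j = ℤ.+ Fib n (ℤ.+ (r ℕ.+ 1 ℕ.+ toℕ j) ℤ.- ℤ.+ toℕ i)

fibMatrix-cong : ∀ n r i {j j'} → toℕ j ≡ toℕ j' → fibMatrix n r i j ≡ fibMatrix n r i j'
fibMatrix-cong n r i j≡j' = cong (fibMatrix n r i) (toℕ-injective j≡j')

fibMatrix-shift : ∀ n r i {j j'} → toℕ j' ≡ suc (toℕ j) →
  fibMatrix n (suc r) i j ≡ fibMatrix n r i j'
fibMatrix-shift n r i {j} j'≡1+j = cong (λ x → ℤ.+ Fib n (ℤ.+ x ℤ.- ℤ.+ toℕ i))
  (trans (sym (ℕP.+-suc (r ℕ.+ 1) (toℕ j))) (cong (r ℕ.+ 1 ℕ.+_) (sym j'≡1+j)))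

fibMatrix-last-column : ∀ n r (i : Fin (suc n)) →
  fibMatrix (suc n) (suc r) i (fromℕ n) ≡ sum (fibMatrix (suc n) r i)
fibMatrix-last-column n r i = begin
  ℤ.+ Fib N (ℤ.+ (suc r ℕ.+ 1 ℕ.+ toℕ (fromℕ n)) ℤ.- ℤ.+ a)
    ≡⟨ cong ℤ.+_ (Fib-sub N _ a) ⟩
  ℤ.+ Fℕ N ((suc r ℕ.+ 1 ℕ.+ toℕ (fromℕ n)) ∸ a)
    ≡⟨ cong (ℤ.+_ ∘ Fℕ N) index≡ ⟩
  ℤ.+ Fℕ N (suc (suc (r ℕ.+ c)))
    ≡⟨ Fℕ-recurrence n (r ℕ.+ c) ⟩
  sum (λ (t : Fin N) → ℤ.+ Fℕ N (suc (r ℕ.+ c) ∸ toℕ t))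
    ≡⟨ ∑-permute {N} (λ t → ℤ.+ Fℕ N (suc (r ℕ.+ c) ∸ toℕ t)) reverse ⟩
  sum (λ (t : Fin N) → ℤ.+ Fℕ N (suc (r ℕ.+ c) ∸ toℕ (opposite t)))
    ≡⟨ sum-cong-≗ entry≡ ⟩
  sum (fibMatrix N r i)
    ∎
  where
  open ≡-Reasoning
  N a c : ℕ
  N = suc n
  a = toℕ i
  c = n ∸ a
  c+a≡n : c ℕ.+ a ≡ n
  c+a≡n = ℕP.m∸n+n≡m (ℕP.≤-pred (toℕ<n i))
  index≡ : (suc r ℕ.+ 1 ℕ.+ toℕ (fromℕ n)) ∸ a ≡ suc (suc (r ℕ.+ c))
  index≡ = begin
    (suc r ℕ.+ 1 ℕ.+ toℕ (fromℕ n)) ∸ a    ≡⟨ cong (λ x → (suc r ℕ.+ 1 ℕ.+ x) ∸ a)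
                                                    (trans (toℕ-fromℕ n) (sym c+a≡n)) ⟩
    (suc r ℕ.+ 1 ℕ.+ (c ℕ.+ a)) ∸ a        ≡⟨ cong (_∸ a) (regroup r c a) ⟩
    (suc (suc (r ℕ.+ c)) ℕ.+ a) ∸ a        ≡⟨ ℕP.m+n∸n≡m _ a ⟩
    suc (suc (r ℕ.+ c))                    ∎
    where
    regroup : ∀ r c a → suc r ℕ.+ 1 ℕ.+ (c ℕ.+ a) ≡ suc (suc (r ℕ.+ c)) ℕ.+ a
    regroup = solve-∀
  entry≡ : ∀ t → ℤ.+ Fℕ N (suc (r ℕ.+ c) ∸ toℕ (opposite t)) ≡ fibMatrix N r i t
  entry≡ t = cong ℤ.+_ (trans (sym (Fib-sub N (suc (r ℕ.+ c)) (toℕ (opposite t))))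
    (cong (Fib N) (pos-sub-pos-≡ {w = a} (begin
      suc (r ℕ.+ c) ℕ.+ a                        ≡⟨ regroupˡ r c a ⟩
      suc r ℕ.+ (c ℕ.+ a)                        ≡⟨ cong (suc r ℕ.+_) (trans c+a≡n (sym u+t≡n)) ⟩
      suc r ℕ.+ (u ℕ.+ toℕ t)                    ≡⟨ regroupʳ r u (toℕ t) ⟩
      r ℕ.+ 1 ℕ.+ toℕ t ℕ.+ u                    ≡⟨ cong (r ℕ.+ 1 ℕ.+ toℕ t ℕ.+_) (sym (opposite-prop t)) ⟩
      r ℕ.+ 1 ℕ.+ toℕ t ℕ.+ toℕ (opposite t)     ∎))))
    where
    u : ℕ
    u = n ∸ toℕ t
    u+t≡n : u ℕ.+ toℕ t ≡ n
    u+t≡n = ℕP.m∸n+n≡m (ℕP.≤-pred (toℕ<n t))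
    regroupˡ : ∀ r c a → suc (r ℕ.+ c) ℕ.+ a ≡ suc r ℕ.+ (c ℕ.+ a)
    regroupˡ = solve-∀
    regroupʳ : ∀ r u t → suc r ℕ.+ (u ℕ.+ t) ≡ r ℕ.+ 1 ℕ.+ t ℕ.+ u
    regroupʳ = solve-∀

det-fibMatrix-zero : ∀ n → det (suc n) (fibMatrix (suc n) 0) ≡ ℤ.1ℤ
det-fibMatrix-zero n = det-upper-unitriangular (suc n) (fibMatrix (suc n) 0) below-diagonal diagonal
  where
  below-diagonal : ∀ i j → toℕ j < toℕ i → fibMatrix (suc n) 0 i j ≡ +0
  below-diagonal i j j<i = cong ℤ.+_ (trans (Fib-sub (suc n) (suc (toℕ j)) (toℕ i))
    (trans (cong (Fℕ (suc n)) (ℕP.m≤n⇒m∸n≡0 j<i)) (Fℕ-zero (suc n))))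
  diagonal : ∀ i → fibMatrix (suc n) 0 i i ≡ ℤ.1ℤ
  diagonal i = cong ℤ.+_ (trans (Fib-sub (suc n) (suc (toℕ i)) (toℕ i))
    (cong (Fℕ (suc n)) (ℕP.m+n∸n≡m 1 (toℕ i))))

-- Linearity of det in the last column of fibMatrix (suc n) (suc r) splits it into these
-- summands, one for each column t of fibMatrix (suc n) r.
fibSummand : ∀ n r → Fin (suc n) → Matrix (suc n)
fibSummand n r t = setColumn (fibMatrix (suc n) (suc r)) (fromℕ n) (λ i → fibMatrix (suc n) r i t)

det-fibSummand-zero : ∀ n r →
  det (suc n) (fibSummand n r zero) ≡ sgn n * det (suc n) (fibMatrix (suc n) r)
det-fibSummand-zero n r = trans (det-cong (suc n) rotated) (det-rotate (suc n) n n<1+n (M r))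
  where
  M : ℕ → Matrix (suc n)
  M = fibMatrix (suc n)
  n<1+n : n < suc n
  n<1+n = ℕP.n<1+n n
  rotated : ∀ i j → fibSummand n r zero i j ≡ M r i (rotate n n<1+n j)
  rotated i j = by-cases (j Fin.≟ fromℕ n)
    where
    by-cases : Dec (j ≡ fromℕ n) → fibSummand n r zero i j ≡ M r i (rotate n n<1+n j)
    by-cases (yes refl) = trans (setColumn-≡ (M (suc r)) (fromℕ n) (λ i → M r i zero) i)
      (fibMatrix-cong (suc n) r i (sym (rotate-≡ n n<1+n (fromℕ n) (toℕ-fromℕ n))))
    by-cases (no j≢n) = trans (setColumn-≢ (M (suc r)) _ i j≢n)
      (fibMatrix-shift (suc n) r i (rotate-< n n<1+n j j<n))
      where
      j<n : toℕ j < n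
      j<n = ℕP.≤∧≢⇒< (ℕP.≤-pred (toℕ<n j))
                     (λ j≡n → j≢n (toℕ-injective (trans j≡n (sym (toℕ-fromℕ n)))))

det-fibSummand-suc : ∀ n r t → det (suc n) (fibSummand n r (suc t)) ≡ +0
det-fibSummand-suc n r t = det-equal-columns (suc n) (fibSummand n r (suc t)) t<n equal
  where
  M : ℕ → Matrix (suc n)
  M = fibMatrix (suc n)
  t<n : toℕ (inject₁ t) < toℕ (fromℕ n)
  t<n = subst₂ _<_ (sym (toℕ-inject₁ t)) (sym (toℕ-fromℕ n)) (toℕ<n t)
  equal : ∀ i → fibSummand n r (suc t) i (inject₁ t) ≡ fibSummand n r (suc t) i (fromℕ n)
  equal i = begin
    fibSummand n r (suc t) i (inject₁ t)
      ≡⟨ setColumn-≢ (M (suc r)) _ i (λ e → ℕP.<-irrefl (cong toℕ e) t<n) ⟩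
    M (suc r) i (inject₁ t)
      ≡⟨ fibMatrix-shift (suc n) r i (cong suc (sym (toℕ-inject₁ t))) ⟩
    M r i (suc t)
      ≡⟨ setColumn-≡ (M (suc r)) (fromℕ n) (λ i → M r i (suc t)) i ⟨
    fibSummand n r (suc t) i (fromℕ n)
      ∎
    where open ≡-Reasoning

det-fibMatrix-suc : ∀ n r →
  det (suc n) (fibMatrix (suc n) (suc r)) ≡ sgn n * det (suc n) (fibMatrix (suc n) r)
det-fibMatrix-suc n r = begin
  det (suc n) M′
    ≡⟨ det-linear-column (suc n) (fromℕ n) M′ (fibSummand n r) last-column other-columns ⟩
  det (suc n) (fibSummand n r zero) + sum (λ t → det (suc n) (fibSummand n r (suc t)))
    ≡⟨ cong₂ _+_ (det-fibSummand-zero n r) (sum-zero (det-fibSummand-suc n r)) ⟩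
  sgn n * det (suc n) (fibMatrix (suc n) r) + +0
    ≡⟨ ℤP.+-identityʳ _ ⟩
  sgn n * det (suc n) (fibMatrix (suc n) r)
    ∎
  where
  open ≡-Reasoning
  M′ : Matrix (suc n)
  M′ = fibMatrix (suc n) (suc r)
  last-column : ∀ i → M′ i (fromℕ n) ≡ sum (λ t → fibSummand n r t i (fromℕ n))
  last-column i = trans (fibMatrix-last-column n r i)
    (sum-cong-≗ (λ t → sym (setColumn-≡ M′ (fromℕ n) (λ i → fibMatrix (suc n) r i t) i)))
  other-columns : ∀ t i j → j ≢ fromℕ n → fibSummand n r t i j ≡ M′ i j
  other-columns t i j = setColumn-≢ M′ _ i

det-fibMatrix : ∀ n r → det (suc n) (fibMatrix (suc n) r) ≡ sgn (n ℕ.* r)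
det-fibMatrix n zero    = trans (det-fibMatrix-zero n) (cong sgn (sym (ℕP.*-zeroʳ n)))
det-fibMatrix n (suc r) = begin
  det (suc n) (fibMatrix (suc n) (suc r))  ≡⟨ det-fibMatrix-suc n r ⟩
  sgn n * det (suc n) (fibMatrix (suc n) r) ≡⟨ cong (sgn n *_) (det-fibMatrix n r) ⟩
  sgn n * sgn (n ℕ.* r)                     ≡⟨ sgn-+ n (n ℕ.* r) ⟨
  sgn (n ℕ.+ n ℕ.* r)                       ≡⟨ cong sgn (ℕP.*-suc n r) ⟨
  sgn (n ℕ.* suc r)                         ∎
  where open ≡-Reasoning

mainTheorem2 : (n r : ℕ) → 2 ≤ n → 1 ≤ r →
    det n (λ i j → ℤ.+ Fib n ((ℤ.+ (r ℕ.+ 1 ℕ.+ toℕ j)) ℤ.- (ℤ.+ toℕ i)))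
      ≡ sgn ((n ∸ 1) ℕ.* r)
mainTheorem2 (suc n) r _ _ = det-fibMatrix n r
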